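{- Fix an integer $k>2$. For all integers $n>m\ge 4k^2$, $d(m,n)\le \sqrt{m}/2$.
   Context: For a function $f:\mathbb N\to\mathbb N$, $f^{(0)}(x)=x$ and $f^{(n+1)}(x)=f(f^{(n)}(x))$. Define $f_i:\mathbb N\to\mathbb N$ for $i\ge1$ by $f_1(n)=n+1$ and $f_{i+1}(n)=f_i^{(\lfloor\sqrt n/2\rfloor)}(n)$. With $k>2$ fixed, for $m,n\ge 4k^2$ and $i\ge1$ let $d_i(m,n)=|\{l\in\mathbb N: m<f_i^{(l)}(4k^2)\le n\}|$. For $n>m\ge 4k^2$, let $I(m,n)$ be the greatest $i\ge1$ for which $d_i(m,n)>0$, and let $d(m,n)=d_{I(m,n)}(m,n)$. -}

module Defs where

open import Data.Nat using (ℕ; zero; suc; _+_; _*_; _≤_; _<_; _≤?_; ⌊_/2⌋)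
open import Data.List using (List; length)
open import Data.List.Membership.Propositional using (_∈_)
open import Data.List.Relation.Unary.Unique.Propositional using (Unique)
open import Data.Product using (Σ; _×_)
open import Function.Bundles using (_⇔_)
open import Relation.Nullary.Decidable using (does)
open import Data.Bool using (if_then_else_)
open import Relation.Binary.PropositionalEquality using (_≡_)

iter : (ℕ → ℕ) → ℕ → ℕ → ℕ
iter f zero    x = x
iter f (suc n) x = f (iter f n x)

-- isqrt n = ⌊√n⌋, the largest s with s * s ≤ n (computed incrementally)
isqrt : ℕ → ℕ
isqrt zero    = zero
isqrt (suc n) =
  if does (suc (isqrt n) * suc (isqrt n) ≤? suc n) then suc (isqrt n) else isqrt n

-- ⌊√n / 2⌋ = ⌊⌊√n⌋ / 2⌋
halfSqrt : ℕ → ℕ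
halfSqrt n = ⌊ isqrt n /2⌋

-- f i for i ≥ 1 : f 1 n = n + 1, f (i+1) n = (f i)^(⌊√n/2⌋)(n).
-- (index 0 is junk, set equal to f 1; it is never used in the statement)
f : ℕ → ℕ → ℕ
f zero          n = suc n
f (suc zero)    n = suc n
f (suc (suc i)) n = iter (f (suc i)) (halfSqrt n) n

HasCard : (ℕ → Set) → ℕ → Set
HasCard P c = Σ (List ℕ) λ xs → Unique xs × (∀ l → (P l ⇔ (l ∈ xs))) × (length xs ≡ c)

DSet : ℕ → ℕ → ℕ → ℕ → ℕ → Set
DSet k i m n l = (m < iter (f i) l (4 * (k * k))) × (iter (f i) l (4 * (k * k)) ≤ n)

DiIs : ℕ → ℕ → ℕ → ℕ → ℕ → Set
DiIs k i m n c = HasCard (DSet k i m n) c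

-- Write o_i(l) = f_i^(l)(4k²). Each f_i is inflationary above 4, so each orbit o_i is strictly
-- increasing and d_i(m,n) is the difference of the positions of n and m in o_i. Every point of
-- o_(i+1) is a point y = o_i(t) of o_i, and its successor is o_i(t + ⌊√y/2⌋). If o_(I+1) jumps
-- over (m, n], let y = o_I(t) ≤ m be its last point up to m: then the points of o_I in (m, n] are
-- among o_I(t+1), ..., o_I(t + ⌊√y/2⌋), so d_I(m,n) ≤ ⌊√y/2⌋ ≤ ⌊√m/2⌋. The greatest I exists
-- because d_1(m,n) > 0 (f_1 is the successor) and, as 4k² ≥ 16 makes ⌊√y/2⌋ ≥ 2,
-- f_j(4k²) ≥ j + 4k² > n for j > n.
module Submission where

open import Defs
open import Data.Nat using (ℕ; zero; suc; s≤s⁻¹; _+_; _*_; _∸_; _≤_; _<_; _≤′_; ≤′-refl; ≤′-step; _≤?_; _<?_; z≤n; s≤s; ⌊_/2⌋; ⌈_/2⌉)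
open import Data.Nat.Properties
open import Data.Nat.Tactic.RingSolver using (solve-∀)
open import Data.Bool using (if_then_else_)
open import Data.List using (applyUpTo)
open import Data.List.Properties using (length-applyUpTo)
open import Data.List.Membership.Propositional using (_∈_)
open import Data.List.Membership.Propositional.Properties using (∈-applyUpTo⁺; ∈-applyUpTo⁻)
open import Data.List.Relation.Unary.Unique.Propositional.Properties using (applyUpTo⁺₁)
open import Data.Product using (Σ; ∃; _×_; _,_)
open import Data.Product.Function.NonDependent.Propositional using (_×-⇔_)
open import Data.Sum using ([_,_]′)
open import Function.Base using (_∘_)
open import Function.Bundles using (_⇔_; mk⇔; Equivalence)
import Function.Properties.Equivalence as ⇔
open import Relation.Binary.Core using (_Preserves_⟶_)
open import Relation.Nullary using (¬_; Dec; yes; no; contradiction)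
open import Relation.Nullary.Decidable using (does)
open import Relation.Unary using (Decidable)
open import Relation.Binary.PropositionalEquality using (_≡_; refl; cong; subst; module ≡-Reasoning)

open Equivalence using (to; from)

orbit : (ℕ → ℕ) → ℕ → ℕ → ℕ
orbit g x l = iter g l x

iter-+ : ∀ g p q x → iter g p (iter g q x) ≡ iter g (p + q) x
iter-+ g zero    q x = refl
iter-+ g (suc p) q x = cong g (iter-+ g p q x)

monotone-stepwise : ∀ {s : ℕ → ℕ} → (∀ l → s l ≤ s (suc l)) → s Preserves _≤_ ⟶ _≤_
monotone-stepwise {s} step l≤l′ = go (≤⇒≤′ l≤l′)
  where
  go : ∀ {l l′} → l ≤′ l′ → s l ≤ s l′
  go ≤′-refl       = ≤-refl
  go (≤′-step l≤′) = ≤-trans (go l≤′) (step _)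

StrictlyIncreasing : (ℕ → ℕ) → Set
StrictlyIncreasing s = ∀ l → s l < s (suc l)

record Bracket (s : ℕ → ℕ) (x : ℕ) : Set where
  constructor bracket
  field
    index : ℕ
    lower : s index ≤ x
    upper : x < s (suc index)

open Bracket

bracket-between : ∀ s x B → s 0 ≤ x → x < s B → Bracket s x
bracket-between s x zero    s0≤x x<s0 = contradiction s0≤x (<⇒≱ x<s0)
bracket-between s x (suc B) s0≤x x<sB with s B ≤? x
... | yes sB≤x = bracket B sB≤x x<sB
... | no  sB≰x = bracket-between s x B s0≤x (≰⇒> sB≰x)

HasCard-resp-⇔ : ∀ {P Q : ℕ → Set} {c} → (∀ l → P l ⇔ Q l) → HasCard P c → HasCard Q c
HasCard-resp-⇔ P⇔Q (xs , unique , P⇔∈ , len) =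
  xs , unique , (λ l → ⇔.trans (⇔.sym (P⇔Q l)) (P⇔∈ l)) , len

interval-card : ∀ a b → HasCard (λ l → a ≤ l × l < b) (b ∸ a)
interval-card a b =
  applyUpTo (a +_) (b ∸ a) ,
  applyUpTo⁺₁ (a +_) (b ∸ a) (λ i<j _ → <⇒≢ i<j ∘ +-cancelˡ-≡ a _ _) ,
  (λ l → mk⇔ (into l) (out l)) ,
  length-applyUpTo (a +_) (b ∸ a)
  where
  into : ∀ l → a ≤ l × l < b → l ∈ applyUpTo (a +_) (b ∸ a)
  into l (a≤l , l<b) = subst (_∈ applyUpTo (a +_) (b ∸ a)) (m+[n∸m]≡n a≤l)
                         (∈-applyUpTo⁺ (a +_) (∸-monoˡ-< l<b a≤l))
  out : ∀ l → l ∈ applyUpTo (a +_) (b ∸ a) → a ≤ l × l < b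
  out l l∈ with ∈-applyUpTo⁻ (a +_) l∈
  ... | i , i<b∸a , refl = m≤m+n a i , ≰⇒> b≰a+i
    where
    b≰a+i : ¬ b ≤ a + i
    b≰a+i b≤a+i = <⇒≱ i<b∸a (subst (b ∸ a ≤_) (m+n∸m≡n a i) (∸-monoˡ-≤ a b≤a+i))

module Increasing {s : ℕ → ℕ} (s-inc : StrictlyIncreasing s) where

  mono-≤ : s Preserves _≤_ ⟶ _≤_
  mono-≤ = monotone-stepwise (λ l → <⇒≤ (s-inc l))

  mono-< : s Preserves _<_ ⟶ _<_
  mono-< {l} l<l′ = <-≤-trans (s-inc l) (mono-≤ l<l′)

  n≤s[n] : ∀ l → l ≤ s l
  n≤s[n] zero    = z≤n
  n≤s[n] (suc l) = <-≤-trans (s≤s (n≤s[n] l)) (s-inc l)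

  bracketOf : ∀ x → s 0 ≤ x → Bracket s x
  bracketOf x s0≤x = bracket-between s x (suc x) s0≤x (n≤s[n] (suc x))

  module _ {x : ℕ} (b : Bracket s x) where

    ≤x⇔≤index : ∀ l → s l ≤ x ⇔ l ≤ index b
    ≤x⇔≤index l = mk⇔ (λ sl≤x → ≮⇒≥ (λ i<l → <⇒≱ (upper b) (≤-trans (mono-≤ i<l) sl≤x)))
                      (λ l≤i → ≤-trans (mono-≤ l≤i) (lower b))

    x<⇔index< : ∀ l → x < s l ⇔ index b < l
    x<⇔index< l = mk⇔ (λ x<sl → ≰⇒> (λ l≤i → <⇒≱ x<sl (from (≤x⇔≤index l) l≤i)))
                      (λ i<l → <-≤-trans (upper b) (mono-≤ i<l))

  count-between : ∀ {m n} (bm : Bracket s m) (bn : Bracket s n) →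
                  HasCard (λ l → m < s l × s l ≤ n) (index bn ∸ index bm)
  count-between bm bn =
    HasCard-resp-⇔ (λ l → ⇔.sym (x<⇔index< bm l ×-⇔ ⇔.trans (≤x⇔≤index bn l) ≤⇔<suc))
                   (interval-card (suc (index bm)) (suc (index bn)))
    where
    ≤⇔<suc : ∀ {l i} → l ≤ i ⇔ l < suc i
    ≤⇔<suc = mk⇔ s≤s s≤s⁻¹

InflationaryFrom : ℕ → (ℕ → ℕ) → Set
InflationaryFrom b g = ∀ y → b ≤ y → y < g y

module _ {b : ℕ} {g : ℕ → ℕ} (g-infl : InflationaryFrom b g) {x : ℕ} (b≤x : b ≤ x) where

  orbit-≥ : ∀ l → b ≤ orbit g x l
  orbit-≥ zero    = b≤x
  orbit-≥ (suc l) = ≤-trans (orbit-≥ l) (<⇒≤ (g-infl _ (orbit-≥ l)))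

  orbit-increasing : StrictlyIncreasing (orbit g x)
  orbit-increasing l = g-infl _ (orbit-≥ l)

iterBy : (ℕ → ℕ) → (ℕ → ℕ) → ℕ → ℕ
iterBy h g y = iter g (h y) y

orbit-iterBy : ∀ h g x l → ∃ λ t → orbit (iterBy h g) x l ≡ orbit g x t
orbit-iterBy h g x zero    = 0 , refl
orbit-iterBy h g x (suc l) with orbit-iterBy h g x l
... | t , eq = h (orbit g x t) + t , (begin
    iterBy h g (orbit (iterBy h g) x l)       ≡⟨ cong (iterBy h g) eq ⟩
    iter g (h (orbit g x t)) (orbit g x t)    ≡⟨ iter-+ g (h (orbit g x t)) t x ⟩
    orbit g x (h (orbit g x t) + t)           ∎)
  where open ≡-Reasoning

module _ {h g : ℕ → ℕ} {x : ℕ} (g-inc : StrictlyIncreasing (orbit g x))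
         (h-mono : h Preserves _≤_ ⟶ _≤_) where
  open Increasing g-inc

  count-≤-jump : ∀ {m n} (bm : Bracket (orbit g x) m) (bn : Bracket (orbit g x) n)
                 (Bm : Bracket (orbit (iterBy h g) x) m) →
                 n < orbit (iterBy h g) x (suc (index Bm)) → index bn ∸ index bm ≤ h m
  count-≤-jump {m} {n} bm bn Bm n<jump with orbit-iterBy h g x (index Bm)
  ... | t , eq = m≤n+o⇒m∸n≤o (index bn) (index bm) (<⇒≤ (<-≤-trans index-bn<t+hy t+hy≤))
    where
    y = orbit g x t
    y≤m : y ≤ m
    y≤m = subst (_≤ m) eq (lower Bm)
    jump≡ : orbit (iterBy h g) x (suc (index Bm)) ≡ orbit g x (t + h y)
    jump≡ = begin
      iterBy h g (orbit (iterBy h g) x (index Bm)) ≡⟨ cong (iterBy h g) eq ⟩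
      iter g (h y) y                               ≡⟨ iter-+ g (h y) t x ⟩
      orbit g x (h y + t)                          ≡⟨ cong (orbit g x) (+-comm (h y) t) ⟩
      orbit g x (t + h y)                          ∎
      where open ≡-Reasoning
    index-bn<t+hy : index bn < t + h y
    index-bn<t+hy = to (x<⇔index< bn (t + h y)) (subst (n <_) jump≡ n<jump)
    t+hy≤ : t + h y ≤ index bm + h m
    t+hy≤ = +-mono-≤ (to (≤x⇔≤index bm t) y≤m) (h-mono y≤m)

if-does-elim : ∀ {P : Set} (P? : Dec P) (R : ℕ → Set) {x y : ℕ} →
               (P → R x) → (¬ P → R y) → R (if does P? then x else y)
if-does-elim (yes p) R onYes onNo = onYes p
if-does-elim (no ¬p) R onYes onNo = onNo ¬p

isqrt-step : ∀ n → isqrt n ≤ isqrt (suc n)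
isqrt-step n = if-does-elim (suc (isqrt n) * suc (isqrt n) ≤? suc n) (isqrt n ≤_)
                 (λ _ → n≤1+n (isqrt n)) (λ _ → ≤-refl)

isqrt[n]*isqrt[n]≤n : ∀ n → isqrt n * isqrt n ≤ n
isqrt[n]*isqrt[n]≤n zero    = z≤n
isqrt[n]*isqrt[n]≤n (suc n) = if-does-elim (suc (isqrt n) * suc (isqrt n) ≤? suc n) (λ r → r * r ≤ suc n)
                                (λ sq≤ → sq≤) (λ _ → m≤n⇒m≤1+n (isqrt[n]*isqrt[n]≤n n))

isqrt-maximal : ∀ {s} n → s * s ≤ n → s ≤ isqrt n
isqrt-maximal {zero}  _       _   = z≤n
isqrt-maximal {suc s} (suc n) sq≤ =
  if-does-elim (suc (isqrt n) * suc (isqrt n) ≤? suc n) (suc s ≤_)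
    (λ _ → s≤s (isqrt-maximal n (s≤s⁻¹ (≤-trans (*-mono-< (n<1+n s) (n<1+n s)) sq≤))))
    (λ ¬next≤ → ≮⇒≥ (λ i<1+s → ¬next≤ (≤-trans (*-mono-≤ i<1+s i<1+s) sq≤)))

halfSqrt-mono : halfSqrt Preserves _≤_ ⟶ _≤_
halfSqrt-mono = ⌊n/2⌋-mono ∘ monotone-stepwise isqrt-step

m≤halfSqrt[n]⇒4*[m*m]≤n : ∀ {m n} → m ≤ halfSqrt n → 4 * (m * m) ≤ n
m≤halfSqrt[n]⇒4*[m*m]≤n {m} {n} m≤ = begin
  4 * (m * m)         ≡⟨ 4*[m*m]≡[m+m]*[m+m] m ⟩
  (m + m) * (m + m)   ≤⟨ *-mono-≤ 2m≤ 2m≤ ⟩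
  isqrt n * isqrt n   ≤⟨ isqrt[n]*isqrt[n]≤n n ⟩
  n                   ∎
  where
  open ≤-Reasoning
  4*[m*m]≡[m+m]*[m+m] : ∀ m → 4 * (m * m) ≡ (m + m) * (m + m)
  4*[m*m]≡[m+m]*[m+m] = solve-∀
  s = isqrt n
  2m≤ : m + m ≤ s
  2m≤ = begin
    m + m               ≤⟨ +-mono-≤ m≤ (≤-trans m≤ (⌊n/2⌋≤⌈n/2⌉ s)) ⟩
    ⌊ s /2⌋ + ⌈ s /2⌉   ≡⟨ ⌊n/2⌋+⌈n/2⌉≡n s ⟩
    s                   ∎

-- The bounds on halfSqrt go through isqrt-maximal: normalising isqrt 16 takes exponential time,
-- since each unfolding of isqrt copies the recursive call.
f-inflationary : ∀ i → InflationaryFrom 4 (f i)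
f-inflationary zero          y _   = n<1+n y
f-inflationary (suc zero)    y _   = n<1+n y
f-inflationary (suc (suc i)) y 4≤y =
  Increasing.mono-< (orbit-increasing (f-inflationary (suc i)) 4≤y)
                    (⌊n/2⌋-mono (isqrt-maximal {2} y 4≤y))

f-≥-index : ∀ i {y} → 16 ≤ y → i + y ≤ f i y
f-≥-index zero          {y} _     = n≤1+n y
f-≥-index (suc zero)        _     = ≤-refl
f-≥-index (suc (suc i)) {y} 16≤y = begin
  suc (suc i + y)      ≤⟨ s≤s (f-≥-index (suc i) 16≤y) ⟩
  suc (g y)            ≤⟨ f-inflationary (suc i) (g y) 4≤gy ⟩
  orbit g y 2          ≤⟨ Increasing.mono-≤ g-orbit-increasing (⌊n/2⌋-mono (isqrt-maximal {4} y 16≤y)) ⟩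
  f (suc (suc i)) y    ∎
  where
  open ≤-Reasoning
  g = f (suc i)
  4≤y : 4 ≤ y
  4≤y = ≤-trans (m≤m+n 4 12) 16≤y
  4≤gy : 4 ≤ g y
  4≤gy = ≤-trans 4≤y (<⇒≤ (f-inflationary (suc i) y 4≤y))
  g-orbit-increasing : StrictlyIncreasing (orbit g y)
  g-orbit-increasing = orbit-increasing (f-inflationary (suc i)) 4≤y

greatest-below : ∀ {P : ℕ → Set} {i₀} → Decidable P → P i₀ → ∀ B → (∀ j → B < j → ¬ P j) →
                 ∃ λ I → i₀ ≤ I × P I × (∀ j → I < j → ¬ P j)
greatest-below {P} {i₀} P? pi₀ B none-above with P? B
... | yes pB = B , ≮⇒≥ (λ B<i₀ → none-above i₀ B<i₀ pi₀) , pB , none-above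
... | no ¬pB = descend B none-from-B
  where
  none-from-B : ∀ j → B ≤ j → ¬ P j
  none-from-B j B≤j = [ none-above j , (λ { refl → ¬pB }) ]′ (m≤n⇒m<n∨m≡n B≤j)
  descend : ∀ B → (∀ j → B ≤ j → ¬ P j) → ∃ λ I → i₀ ≤ I × P I × (∀ j → I < j → ¬ P j)
  descend zero    none = contradiction pi₀ (none i₀ z≤n)
  descend (suc B) none = greatest-below P? pi₀ B none

module Orbits {k m n : ℕ} (2<k : 2 < k) (a≤m : 4 * (k * k) ≤ m) (m<n : m < n) where

  a : ℕ
  a = 4 * (k * k)

  16≤a : 16 ≤ a
  16≤a = ≤-trans (m≤m+n 16 20) (*-monoʳ-≤ 4 (*-mono-≤ 2<k 2<k))

  f-orbit-increasing : ∀ i → StrictlyIncreasing (orbit (f i) a)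
  f-orbit-increasing i = orbit-increasing (f-inflationary i) (≤-trans (m≤m+n 4 12) 16≤a)

  module _ (i : ℕ) where
    open Increasing (f-orbit-increasing i)

    bracket-m : Bracket (orbit (f i) a) m
    bracket-m = bracketOf m a≤m

    bracket-n : Bracket (orbit (f i) a) n
    bracket-n = bracketOf n (≤-trans a≤m (<⇒≤ m<n))

  L R : ℕ → ℕ
  L i = index (bracket-m i)
  R i = index (bracket-n i)

  d-card : ∀ i → DiIs k i m n (R i ∸ L i)
  d-card i = Increasing.count-between (f-orbit-increasing i) (bracket-m i) (bracket-n i)

  Meets : ℕ → Set
  Meets i = L i < R i

  next≤n⇒meets : ∀ i → orbit (f i) a (suc (L i)) ≤ n → Meets i
  next≤n⇒meets i = to (Increasing.≤x⇔≤index (f-orbit-increasing i) (bracket-n i) (suc (L i)))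

  meets-1 : Meets 1
  meets-1 = next≤n⇒meets 1 (≤-trans (s≤s (lower (bracket-m 1))) m<n)

  ¬meets-beyond : ∀ j → n < j → ¬ Meets j
  ¬meets-beyond j n<j meets = <⇒≱ n<j (begin
    j                            ≤⟨ m≤m+n j a ⟩
    j + a                        ≤⟨ f-≥-index j 16≤a ⟩
    orbit (f j) a 1              ≤⟨ mono-≤ (s≤s (z≤n {L j})) ⟩
    orbit (f j) a (suc (L j))    ≤⟨ from (≤x⇔≤index (bracket-n j) (suc (L j))) meets ⟩
    n                            ∎)
    where
    open ≤-Reasoning
    open Increasing (f-orbit-increasing j)

  count-≤-halfSqrt : ∀ i → 1 ≤ i → ¬ Meets (suc i) → R i ∸ L i ≤ halfSqrt m
  count-≤-halfSqrt (suc i) _ ¬meets =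
    count-≤-jump (f-orbit-increasing (suc i)) halfSqrt-mono
      (bracket-m (suc i)) (bracket-n (suc i)) (bracket-m (suc (suc i)))
      (≰⇒> (¬meets ∘ next≤n⇒meets (suc (suc i))))

mainTheorem2 : (k m n : ℕ) → 2 < k → 4 * (k * k) ≤ m → m < n →
    Σ ℕ λ I → Σ ℕ λ d →
      (1 ≤ I) × DiIs k I m n d × (0 < d) ×
      ((j : ℕ) → I < j → DiIs k j m n 0) ×
      (4 * (d * d) ≤ m)
mainTheorem2 k m n 2<k a≤m m<n =
  let I , 1≤I , meets-I , maximal = greatest-below (λ i → L i <? R i) meets-1 n ¬meets-beyond in
  I , R I ∸ L I , 1≤I , d-card I , m<n⇒0<n∸m meets-I ,
  (λ j I<j → subst (DiIs k j m n) (m≤n⇒m∸n≡0 (≮⇒≥ (maximal j I<j))) (d-card j)) ,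
  m≤halfSqrt[n]⇒4*[m*m]≤n (count-≤-halfSqrt I 1≤I (maximal (suc I) ≤-refl))
  where open Orbits 2<k a≤m m<n
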